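{- Let $G$ be a partial cube with at least three vertices and with $\Theta$-classes $E_1,\ldots,E_d$. Then \begin{align*} \widehat{WW}(G) &= \sum_{i=1}^d\left(n_i^0n_i^1(n_i^1-1)+n_i^1n_i^0(n_i^0-1)\right)\\ &\quad+2\sum_{i=1}^{d-1}\sum_{j=i+1}^d\Big(3n_{ij}^{00}n_{ij}^{01}n_{ij}^{10}+3n_{ij}^{00}n_{ij}^{01}n_{ij}^{11}+3n_{ij}^{00}n_{ij}^{10}n_{ij}^{11}+3n_{ij}^{01}n_{ij}^{10}n_{ij}^{11}\\ &\qquad+n_{ij}^{00}n_{ij}^{11}(n_{ij}^{11}-1)+n_{ij}^{01}n_{ij}^{10}(n_{ij}^{10}-1)+n_{ij}^{10}n_{ij}^{01}(n_{ij}^{01}-1)+n_{ij}^{11}n_{ij}^{00}(n_{ij}^{00}-1)\Big). \end{align*}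
   Context: $d(u,v)$ is the shortest-path distance. $O_3(G)$ is the set of ordered triples $(u,v,w)$ of pairwise distinct vertices of $G$ and $\widehat{WW}(G)=\sum_{(u,v,w)\in O_3(G)}d(u,v)d(u,w)$. A partial cube is a graph isomorphic to an isometric subgraph of a hypercube. Two edges $u_1v_1$, $u_2v_2$ are in relation $\Theta$ if $d(u_1,u_2)+d(v_1,v_2)\ne d(u_1,v_2)+d(v_1,u_2)$; in a partial cube $\Theta$ is an equivalence relation whose classes are the $\Theta$-classes, and for each $\Theta$-class $E_i$ the graph $G-E_i$ has exactly two connected components, denoted $U_i$ and $U_i'$. Set $n_i^0=|V(U_i)|$, $n_i^1=|V(U_i')|$, and for $i\ne j$: $n_{ij}^{00}=|V(U_i)\cap V(U_j)|$, $n_{ij}^{01}=|V(U_i)\cap V(U_j')|$, $n_{ij}^{10}=|V(U_i')\cap V(U_j)|$, $n_{ij}^{11}=|V(U_i')\cap V(U_j')|$. -}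

module Defs where

open import Data.Nat using (ℕ; zero; suc; _+_; _*_; _∸_; _<ᵇ_)
open import Data.Bool using (Bool; true; false; _∧_; not; if_then_else_; _xor_)
open import Data.Fin using (Fin; toℕ; _≟_)
open import Data.List using (List; allFin; map)
open import Data.Nat.ListAction using (sum)
open import Data.Bool.ListAction using (any)
open import Data.Vec using (Vec; zipWith; toList)
open import Data.Product using (Σ; ∃; _×_)
open import Relation.Nullary using (¬_)
open import Relation.Nullary.Decidable using (isYes)
open import Relation.Binary.PropositionalEquality using (_≡_; _≢_)

Adj : ℕ → Set
Adj n = Fin n → Fin n → Bool

IsSimpleGraph : {n : ℕ} → Adj n → Set
IsSimpleGraph {n} A = (∀ (u v : Fin n) → A u v ≡ A v u) × (∀ (u : Fin n) → A u u ≡ false)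

Σ[_] : (n : ℕ) → (Fin n → ℕ) → ℕ
Σ[ n ] f = sum (map f (allFin n))

walkExact : {n : ℕ} → Adj n → ℕ → Fin n → Fin n → Bool
walkExact A zero u v = isYes (u ≟ v)
walkExact {n} A (suc k) u v = any (λ w → A u w ∧ walkExact A k w v) (allFin n)

Reachable : {n : ℕ} → Adj n → Fin n → Fin n → Set
Reachable A u v = ∃ λ k → walkExact A k u v ≡ true

IsConnected : {n : ℕ} → Adj n → Set
IsConnected {n} A = ∀ (u v : Fin n) → Reachable A u v

-- Shortest-path distance: least k with a walk of length k (searching k = 0 .. n-1;
-- in a connected graph on n vertices this is the true distance).
distFrom : {n : ℕ} → Adj n → Fin n → Fin n → ℕ → ℕ → ℕ
distFrom A u v k zero = k
distFrom A u v k (suc fuel) = if walkExact A k u v then k else distFrom A u v (suc k) fuel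

dist : {n : ℕ} → Adj n → Fin n → Fin n → ℕ
dist {n} A u v = distFrom A u v 0 n

-- Hamming distance = shortest-path distance in the hypercube Q_k.
hamming : {k : ℕ} → Vec Bool k → Vec Bool k → ℕ
hamming x y = sum (map (λ b → if b then 1 else 0) (toList (zipWith _xor_ x y)))

IsPartialCube : {n : ℕ} → Adj n → Set
IsPartialCube {n} A =
  IsSimpleGraph A × IsConnected A ×
  (∃ λ (k : ℕ) → Σ (Fin n → Vec Bool k) λ f →
     ∀ (u v : Fin n) → dist A u v ≡ hamming (f u) (f v))

Θ : {n : ℕ} → Adj n → Fin n → Fin n → Fin n → Fin n → Set
Θ A u₁ v₁ u₂ v₂ = dist A u₁ u₂ + dist A v₁ v₂ ≢ dist A u₁ v₂ + dist A v₁ u₂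

-- cls assigns to each edge uv its Θ-class index; the classes are E_1..E_d
-- (cls is only meaningful on edges).
IsThetaClassLabelling : {n : ℕ} → Adj n → (d : ℕ) → (Fin n → Fin n → Fin d) → Set
IsThetaClassLabelling {n} A d cls =
  (∀ (u v u' v' : Fin n) → A u v ≡ true → A u' v' ≡ true →
     (Θ A u v u' v' → cls u v ≡ cls u' v') × (cls u v ≡ cls u' v' → Θ A u v u' v'))
  × (∀ (i : Fin d) → ∃ λ u → ∃ λ v → A u v ≡ true × cls u v ≡ i)

removeClass : {n d : ℕ} → Adj n → (Fin n → Fin n → Fin d) → Fin d → Adj n
removeClass A cls i u v = A u v ∧ not (isYes (cls u v ≟ i))

-- side i v = false means v ∈ U_i, side i v = true means v ∈ U_i'; the condition says
-- two vertices get the same label iff they lie in the same component of G - E_i.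
IsComponentLabelling : {n d : ℕ} → Adj n → (Fin n → Fin n → Fin d) → (Fin d → Fin n → Bool) → Set
IsComponentLabelling {n} {d} A cls side =
  ∀ (i : Fin d) (u v : Fin n) →
    (side i u ≡ side i v → Reachable (removeClass A cls i) u v) ×
    (Reachable (removeClass A cls i) u v → side i u ≡ side i v)

count : (n : ℕ) → (Fin n → Bool) → ℕ
count n p = Σ[ n ] (λ v → if p v then 1 else 0)

_==_ : Bool → Bool → Bool
a == b = not (a xor b)

-- n_i^a  (a = false ↦ 0, true ↦ 1)
nI : {n d : ℕ} → (Fin d → Fin n → Bool) → Fin d → Bool → ℕ
nI {n} side i a = count n (λ v → side i v == a)

nIJ : {n d : ℕ} → (Fin d → Fin n → Bool) → Fin d → Fin d → Bool → Bool → ℕ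
nIJ {n} side i j a b = count n (λ v → (side i v == a) ∧ (side j v == b))

WWhat : {n : ℕ} → Adj n → ℕ
WWhat {n} A = Σ[ n ] λ u → Σ[ n ] λ v → Σ[ n ] λ w →
  if isYes (u ≟ v) then 0 else if isYes (u ≟ w) then 0 else if isYes (v ≟ w) then 0
  else dist A u v * dist A u w

singleTerm : {n d : ℕ} → (Fin d → Fin n → Bool) → Fin d → ℕ
singleTerm side i =
  nI side i false * nI side i true * (nI side i true ∸ 1)
  + nI side i true * nI side i false * (nI side i false ∸ 1)

pairTerm : {n d : ℕ} → (Fin d → Fin n → Bool) → Fin d → Fin d → ℕ
pairTerm side i j =
  let a = nIJ side i j false false
      b = nIJ side i j false true
      c = nIJ side i j true false
      e = nIJ side i j true true
  in 3 * a * b * c + 3 * a * b * e + 3 * a * c * e + 3 * b * c * e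
     + a * e * (e ∸ 1) + b * c * (c ∸ 1) + c * b * (b ∸ 1) + e * a * (a ∸ 1)

rhs : {n : ℕ} → (d : ℕ) → (Fin d → Fin n → Bool) → ℕ
rhs d side =
  Σ[ d ] (λ i → singleTerm side i)
  + 2 * Σ[ d ] (λ i → Σ[ d ] (λ j → if toℕ i <ᵇ toℕ j then pairTerm side i j else 0))

-- In a partial cube, d(u,v) is the number of Θ-classes E_i whose cut separates u from v:
-- an isometric embedding into a hypercube sends all edges of a Θ-class to the same
-- coordinate, and a shortest path changes exactly the coordinates where its ends differ,
-- each once.  Writing δᵢ(u,v) ∈ {0,1} for "E_i separates u and v", we get
-- ŴW(G) + Σ_{u,v} d(u,v)² = Σ_u (Σ_v d(u,v))², because d(u,u) = 0.  Expanding d = Σᵢ δᵢ in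
-- both squares gives a sum over pairs of classes (i,j), and each (i,j)-summand depends only
-- on the sizes of the four cells U_i^(′) ∩ U_j^(′): the difference of the two summands is
-- the polynomial of the theorem, which for i = j degenerates to the single-class term.
module Submission where

open import Defs
open import Data.Bool using (Bool; true; false; _∧_; not; if_then_else_; _xor_; T)
open import Data.Bool.Properties using (T-≡; T-∧; xor-same; ∧-idem)
open import Data.Empty using (⊥-elim)
open import Data.Fin using (Fin; toℕ; _≟_)
import Data.Fin as Fin
open import Data.Fin.Properties using (pigeonhole; toℕ<n)
import Data.Fin.Properties as Finₚ
open import Data.List using (tabulate; allFin)
open import Data.List.Membership.Propositional using (lose)
open import Data.List.Membership.Propositional.Properties using (∈-allFin)
open import Data.List.Properties using (map-tabulate)
open import Data.List.Relation.Unary.Any using (satisfied)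
open import Data.List.Relation.Unary.Any.Properties using (any⁺; any⁻)
open import Data.Nat using (ℕ; zero; suc; _+_; _*_; _∸_; _<ᵇ_; _≤_; _<_; z≤n; s≤s; _≤?_)
open import Data.Nat.Induction using (<-rec)
import Data.Nat.ListAction as List
open import Data.Nat.Properties hiding (_≟_)
open import Data.Nat.Properties using () renaming (_≟_ to _≟ℕ_)
open import Data.Nat.Tactic.RingSolver using (solve-∀)
open import Algebra.Properties.CommutativeSemigroup +-commutativeSemigroup using (x∙yz≈y∙xz)
open import Algebra.Properties.Semiring.Sum +-*-semiring
  using (sum; sum-syntax; sum-cong-≗; sum-replicate-zero; ∑-distrib-+; ∑-comm;
         *-distribˡ-sum; *-distribʳ-sum)
open import Data.Product using (∃; _×_; _,_; proj₁; proj₂)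
open import Data.Sum using (_⊎_; inj₁; inj₂)
import Data.Sum as Sum
open import Data.Unit using (tt)
open import Data.Vec using (Vec; lookup)
import Data.Vec as Vec
open import Function using (_∘_)
open import Function.Bundles using (module Equivalence)
open import Relation.Binary.Definitions using (tri<; tri≈; tri>)
open import Relation.Binary.PropositionalEquality
open import Relation.Nullary using (yes; no)
open import Relation.Nullary.Decidable using (isYes)

𝟙 : Bool → ℕ
𝟙 b = if b then 1 else 0

𝟙≡0⇒false : ∀ {b} → 𝟙 b ≡ 0 → b ≡ false
𝟙≡0⇒false {false} _ = refl

if-≟-yes : ∀ {n} {a b : Fin n} (x y : ℕ) → a ≡ b → (if isYes (a ≟ b) then x else y) ≡ x
if-≟-yes {a = a} {b} x y a≡b with a ≟ b
... | yes _   = refl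
... | no  a≢b = ⊥-elim (a≢b a≡b)

if-≟-no : ∀ {n} {a b : Fin n} (x y : ℕ) → a ≢ b → (if isYes (a ≟ b) then x else y) ≡ y
if-≟-no {a = a} {b} x y a≢b with a ≟ b
... | yes a≡b = ⊥-elim (a≢b a≡b)
... | no  _   = refl

<ᵇ-true : ∀ {m n} → m < n → (m <ᵇ n) ≡ true
<ᵇ-true m<n = Equivalence.to T-≡ (<⇒<ᵇ m<n)

<ᵇ-false : ∀ {m n} → n ≤ m → (m <ᵇ n) ≡ false
<ᵇ-false {m} {n} n≤m with m <ᵇ n in m<ᵇn
... | false = refl
... | true  = ⊥-elim (≤⇒≯ n≤m (<ᵇ⇒< m n (subst T (sym m<ᵇn) tt)))

-- Finite sums

Σ[]≡sum : ∀ n (f : Fin n → ℕ) → Σ[ n ] f ≡ sum f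
Σ[]≡sum n f = trans (cong List.sum (map-tabulate (λ i → i) f)) (sum-tabulate n f)
  where
  sum-tabulate : ∀ n (f : Fin n → ℕ) → List.sum (tabulate f) ≡ sum f
  sum-tabulate zero    f = refl
  sum-tabulate (suc n) f = cong (f Fin.zero +_) (sum-tabulate n (f ∘ Fin.suc))

count≡sum : ∀ n (p : Fin n → Bool) → count n p ≡ ∑[ v < n ] 𝟙 (p v)
count≡sum n p = Σ[]≡sum n (𝟙 ∘ p)

count-+ : ∀ n (p q r : Fin n → Bool) → (∀ v → 𝟙 (p v) ≡ 𝟙 (q v) + 𝟙 (r v)) →
  count n p ≡ count n q + count n r
count-+ n p q r split = begin
  count n p                                   ≡⟨ count≡sum n p ⟩
  ∑[ v < n ] 𝟙 (p v)                          ≡⟨ sum-cong-≗ split ⟩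
  ∑[ v < n ] (𝟙 (q v) + 𝟙 (r v))              ≡⟨ ∑-distrib-+ (𝟙 ∘ q) (𝟙 ∘ r) ⟩
  ∑[ v < n ] 𝟙 (q v) + ∑[ v < n ] 𝟙 (r v)     ≡⟨ cong₂ _+_ (count≡sum n q) (count≡sum n r) ⟨
  count n q + count n r                       ∎
  where open ≡-Reasoning

∑∑-distrib-+ : ∀ {m n} (f g : Fin m → Fin n → ℕ) →
  ∑[ i < m ] ∑[ j < n ] (f i j + g i j)
    ≡ ∑[ i < m ] ∑[ j < n ] f i j + ∑[ i < m ] ∑[ j < n ] g i j
∑∑-distrib-+ f g = trans (sum-cong-≗ (λ i → ∑-distrib-+ (f i) (g i)))
                         (∑-distrib-+ (λ i → sum (f i)) (λ i → sum (g i)))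

∑-comm² : ∀ {m n} (h : Fin m → Fin n → Fin n → ℕ) →
  ∑[ u < m ] ∑[ i < n ] ∑[ j < n ] h u i j ≡ ∑[ i < n ] ∑[ j < n ] ∑[ u < m ] h u i j
∑-comm² h = trans (∑-comm (λ u i → ∑[ j < _ ] h u i j))
                  (sum-cong-≗ (λ i → ∑-comm (λ u j → h u i j)))

sum-*-sum : ∀ {m n} (f : Fin m → ℕ) (g : Fin n → ℕ) →
  sum f * sum g ≡ ∑[ i < m ] ∑[ j < n ] (f i * g j)
sum-*-sum f g = trans (*-distribʳ-sum (sum g) f) (sum-cong-≗ (λ i → *-distribˡ-sum (f i) g))

sum-except : ∀ {n} (f : Fin n → ℕ) i →
  sum f ≡ f i + ∑[ j < n ] (if isYes (i ≟ j) then 0 else f j)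
sum-except f Fin.zero = refl
sum-except {suc n} f (Fin.suc i) = begin
  f Fin.zero + sum (f ∘ Fin.suc)
    ≡⟨ cong (f Fin.zero +_) (sum-except (f ∘ Fin.suc) i) ⟩
  f Fin.zero + (f (Fin.suc i) + ∑[ j < n ] (if isYes (i ≟ j) then 0 else f (Fin.suc j)))
    ≡⟨ x∙yz≈y∙xz (f Fin.zero) (f (Fin.suc i)) _ ⟩
  f (Fin.suc i) + (f Fin.zero + ∑[ j < n ] (if isYes (i ≟ j) then 0 else f (Fin.suc j)))
    ≡⟨ cong (λ s → f (Fin.suc i) + (f Fin.zero + s)) (sum-cong-≗ masked-suc) ⟩
  f (Fin.suc i) + ∑[ j < suc n ] (if isYes (Fin.suc i ≟ j) then 0 else f j) ∎
  where
  open ≡-Reasoning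
  masked-suc : ∀ j → (if isYes (i ≟ j) then 0 else f (Fin.suc j))
                   ≡ (if isYes (Fin.suc i ≟ Fin.suc j) then 0 else f (Fin.suc j))
  masked-suc j with i ≟ j
  ... | yes _ = refl
  ... | no  _ = refl

sum-single : ∀ {n} (f : Fin n → ℕ) i → (∀ j → i ≢ j → f j ≡ 0) → sum f ≡ f i
sum-single {n} f i off = begin
  sum f                                                ≡⟨ sum-except f i ⟩
  f i + ∑[ j < n ] (if isYes (i ≟ j) then 0 else f j)  ≡⟨ cong (f i +_) (sum-cong-≗ masked≡0) ⟩
  f i + ∑[ j < n ] 0                                   ≡⟨ cong (f i +_) (sum-replicate-zero n) ⟩
  f i + 0                                              ≡⟨ +-identityʳ (f i) ⟩
  f i                                                  ∎
  where
  open ≡-Reasoning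
  masked≡0 : ∀ j → (if isYes (i ≟ j) then 0 else f j) ≡ 0
  masked≡0 j with i ≟ j
  ... | yes _  = refl
  ... | no i≢j = off j i≢j

sum≡0⇒≡0 : ∀ {n} (f : Fin n → ℕ) → sum f ≡ 0 → ∀ i → f i ≡ 0
sum≡0⇒≡0 f eq Fin.zero    = m+n≡0⇒m≡0 (f Fin.zero) eq
sum≡0⇒≡0 f eq (Fin.suc i) = sum≡0⇒≡0 (f ∘ Fin.suc) (m+n≡0⇒n≡0 (f Fin.zero) eq) i

sum-≤-≡ : ∀ {n} (f g : Fin n → ℕ) → (∀ i → f i ≤ g i) → sum f ≡ sum g → ∀ i → f i ≡ g i
sum-≤-≡ {n} f g f≤g eq i =
  ≤-antisym (f≤g i) (m∸n≡0⇒m≤n (sum≡0⇒≡0 (λ j → g j ∸ f j) gap≡0 i))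
  where
  open ≡-Reasoning
  gap≡0 : ∑[ j < n ] (g j ∸ f j) ≡ 0
  gap≡0 = +-cancelˡ-≡ (sum f) _ 0 (begin
    sum f + ∑[ j < n ] (g j ∸ f j)  ≡⟨ ∑-distrib-+ f (λ j → g j ∸ f j) ⟨
    ∑[ j < n ] (f j + (g j ∸ f j))  ≡⟨ sum-cong-≗ (λ j → m+[n∸m]≡n (f≤g j)) ⟩
    sum g                           ≡⟨ eq ⟨
    sum f                           ≡⟨ +-identityʳ (sum f) ⟨
    sum f + 0                       ∎)

sum-indicator≡1 : ∀ {n} (g : Fin n → Bool) → ∑[ t < n ] 𝟙 (g t) ≡ 1 →
  ∃ λ c → g c ≡ true × (∀ t → t ≢ c → g t ≡ false)
sum-indicator≡1 {suc n} g eq with g Fin.zero in g₀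
... | true = Fin.zero , g₀ , others
  where
  others : ∀ t → t ≢ Fin.zero → g t ≡ false
  others Fin.zero    t≢0 = ⊥-elim (t≢0 refl)
  others (Fin.suc t) _   = 𝟙≡0⇒false (sum≡0⇒≡0 (𝟙 ∘ g ∘ Fin.suc) (suc-injective eq) t)
... | false with c , gc , others ← sum-indicator≡1 (g ∘ Fin.suc) eq = Fin.suc c , gc , others′
  where
  others′ : ∀ t → t ≢ Fin.suc c → g t ≡ false
  others′ Fin.zero    _   = g₀
  others′ (Fin.suc t) t≢c = others t (t≢c ∘ cong Fin.suc)

sum-reindex : ∀ {m n} (ι : Fin m → Fin n) (h : Fin n → ℕ) →
  (∀ i j → ι i ≡ ι j → i ≡ j) → (∀ t → h t ≢ 0 → ∃ λ i → ι i ≡ t) →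
  sum h ≡ ∑[ i < m ] h (ι i)
sum-reindex {m} {n} ι h ι-injective h-support = begin
  ∑[ t < n ] h t                 ≡⟨ sum-cong-≗ fibre-sum ⟨
  ∑[ t < n ] ∑[ i < m ] hit t i  ≡⟨ ∑-comm hit ⟩
  ∑[ i < m ] ∑[ t < n ] hit t i  ≡⟨ sum-cong-≗ only-at-ι ⟩
  ∑[ i < m ] hit (ι i) i         ≡⟨ sum-cong-≗ (λ i → if-≟-yes (h (ι i)) 0 refl) ⟩
  ∑[ i < m ] h (ι i)             ∎
  where
  open ≡-Reasoning
  hit : Fin n → Fin m → ℕ
  hit t i = if isYes (ι i ≟ t) then h t else 0

  only-at-ι : ∀ i → ∑[ t < n ] hit t i ≡ hit (ι i) i
  only-at-ι i = sum-single (λ t → hit t i) (ι i) (λ t → if-≟-no (h t) 0)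

  fibre-sum : ∀ t → ∑[ i < m ] hit t i ≡ h t
  fibre-sum t with h t ≟ℕ 0
  ... | yes ht≡0 = trans (sum-cong-≗ hit≡0) (trans (sum-replicate-zero m) (sym ht≡0))
    where
    hit≡0 : ∀ i → hit t i ≡ 0
    hit≡0 i with ι i ≟ t
    ... | yes _ = ht≡0
    ... | no  _ = refl
  ... | no ht≢0 with i₀ , ιi₀≡t ← h-support t ht≢0 =
    trans (sum-single (hit t) i₀ off) (if-≟-yes (h t) 0 ιi₀≡t)
    where
    off : ∀ i → i₀ ≢ i → hit t i ≡ 0
    off i i₀≢i = if-≟-no (h t) 0 (λ ιi≡t → i₀≢i (ι-injective i₀ i (trans ιi₀≡t (sym ιi≡t))))

strictlyUpper : ∀ {d} → (Fin d → Fin d → ℕ) → Fin d → Fin d → ℕ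
strictlyUpper M i j = if toℕ i <ᵇ toℕ j then M i j else 0

sum-symmetric : ∀ {d} (M : Fin d → Fin d → ℕ) → (∀ i j → M i j ≡ M j i) →
  ∑[ i < d ] ∑[ j < d ] M i j ≡ ∑[ i < d ] M i i + 2 * ∑[ i < d ] ∑[ j < d ] strictlyUpper M i j
sum-symmetric {d} M M-sym = begin
  ∑∑ M
    ≡⟨ sum-cong-≗ (λ i → sum-cong-≗ (split i)) ⟩
  ∑∑ (λ i j → (above i j + above j i) + diagonal i j)
    ≡⟨ ∑∑-distrib-+ (λ i j → above i j + above j i) diagonal ⟩
  ∑∑ (λ i j → above i j + above j i) + ∑∑ diagonal
    ≡⟨ cong₂ _+_ (∑∑-distrib-+ above (λ i j → above j i)) (sum-cong-≗ diagonal-sum) ⟩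
  (∑∑ above + ∑∑ (λ i j → above j i)) + ∑[ i < d ] M i i
    ≡⟨ cong (λ s → (∑∑ above + s) + ∑[ i < d ] M i i) (∑-comm (λ i j → above j i)) ⟩
  (∑∑ above + ∑∑ above) + ∑[ i < d ] M i i
    ≡⟨ regroup (∑∑ above) (∑[ i < d ] M i i) ⟩
  ∑[ i < d ] M i i + 2 * ∑∑ above ∎
  where
  open ≡-Reasoning
  ∑∑ : (Fin d → Fin d → ℕ) → ℕ
  ∑∑ f = ∑[ i < d ] ∑[ j < d ] f i j

  above diagonal : Fin d → Fin d → ℕ
  above        = strictlyUpper M
  diagonal i j = if isYes (i ≟ j) then M i j else 0

  split : ∀ i j → M i j ≡ (above i j + above j i) + diagonal i j
  split i j with Finₚ.<-cmp i j
  ... | tri< i<j i≢j _ rewrite <ᵇ-true i<j | <ᵇ-false (<⇒≤ i<j) | if-≟-no (M i j) 0 i≢j =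
    sym (trans (+-identityʳ _) (+-identityʳ _))
  ... | tri≈ _ refl _ rewrite <ᵇ-false (≤-refl {toℕ i}) | if-≟-yes (M i i) 0 (refl {x = i}) = refl
  ... | tri> _ i≢j j<i rewrite <ᵇ-false (<⇒≤ j<i) | <ᵇ-true j<i | if-≟-no (M i j) 0 i≢j =
    trans (M-sym i j) (sym (+-identityʳ _))

  diagonal-sum : ∀ i → ∑[ j < d ] diagonal i j ≡ M i i
  diagonal-sum i =
    trans (sum-single (diagonal i) i (λ j → if-≟-no (M i j) 0)) (if-≟-yes (M i i) 0 refl)

  regroup : ∀ u m → (u + u) + m ≡ m + 2 * u
  regroup = solve-∀

-- The sum ŴW

whenDistinct : ∀ {n} → Fin n → Fin n → Fin n → ℕ → ℕ
whenDistinct u v w x =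
  if isYes (u ≟ v) then 0 else if isYes (u ≟ w) then 0 else if isYes (v ≟ w) then 0 else x

ŴW : ∀ {n} → (Fin n → Fin n → ℕ) → ℕ
ŴW {n} D = ∑[ u < n ] ∑[ v < n ] ∑[ w < n ] whenDistinct u v w (D u v * D u w)

WWhat≡ŴW : ∀ {n} (A : Adj n) → WWhat A ≡ ŴW (dist A)
WWhat≡ŴW {n} A =
  trans (Σ[]≡sum n λ u → Σ[ n ] λ v → Σ[ n ] (term u v)) (sum-cong-≗ λ u →
  trans (Σ[]≡sum n λ v → Σ[ n ] (term u v)) (sum-cong-≗ λ v → Σ[]≡sum n (term u v)))
  where
  term : Fin n → Fin n → Fin n → ℕ
  term u v w = whenDistinct u v w (dist A u v * dist A u w)

ŴW-cong : ∀ {n} {D D′ : Fin n → Fin n → ℕ} → (∀ u v → D u v ≡ D′ u v) → ŴW D ≡ ŴW D′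
ŴW-cong eq = sum-cong-≗ λ u → sum-cong-≗ λ v → sum-cong-≗ λ w →
  cong (whenDistinct u v w) (cong₂ _*_ (eq u v) (eq u w))

ŴW+squares : ∀ {n} (D : Fin n → Fin n → ℕ) → (∀ u → D u u ≡ 0) →
  ŴW D + ∑[ u < n ] ∑[ v < n ] (D u v * D u v) ≡ ∑[ u < n ] (sum (D u) * sum (D u))
ŴW+squares {n} D D-refl = begin
  ŴW D + ∑[ u < n ] ∑[ v < n ] (D u v * D u v)
    ≡⟨ ∑∑-distrib-+ distinct (λ u v → D u v * D u v) ⟨
  ∑[ u < n ] ∑[ v < n ] (distinct u v + D u v * D u v)
    ≡⟨ sum-cong-≗ (λ u → sum-cong-≗ (row u)) ⟩
  ∑[ u < n ] ∑[ v < n ] ∑[ w < n ] (D u v * D u w)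
    ≡⟨ sum-cong-≗ (λ u → sum-*-sum (D u) (D u)) ⟨
  ∑[ u < n ] (sum (D u) * sum (D u)) ∎
  where
  open ≡-Reasoning
  distinct : Fin n → Fin n → ℕ
  distinct u v = ∑[ w < n ] whenDistinct u v w (D u v * D u w)

  row : ∀ u v → distinct u v + D u v * D u v ≡ ∑[ w < n ] (D u v * D u w)
  row u v with u ≟ v
  ... | yes refl rewrite D-refl u = +-identityʳ _
  ... | no _ = begin
    ∑[ w < n ] (if isYes (u ≟ w) then 0 else masked w) + D u v * D u v
      ≡⟨ cong (_+ D u v * D u v) (sum-cong-≗ skip-u) ⟩
    sum masked + D u v * D u v
      ≡⟨ +-comm (sum masked) _ ⟩
    D u v * D u v + sum masked
      ≡⟨ sum-except (λ w → D u v * D u w) v ⟨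
    ∑[ w < n ] (D u v * D u w) ∎
    where
    masked : Fin n → ℕ
    masked w = if isYes (v ≟ w) then 0 else D u v * D u w

    -- the terms with w = u vanish anyway, since D u u = 0
    skip-u : ∀ w → (if isYes (u ≟ w) then 0 else masked w) ≡ masked w
    skip-u w with u ≟ w
    ... | no _ = refl
    ... | yes refl with v ≟ u
    ...   | yes _ = refl
    ...   | no  _ = sym (trans (cong (D u v *_) (D-refl u)) (*-zeroʳ (D u v)))

-- Counting by the four cells of two cuts

cellSum : (Bool → Bool → ℕ) → ℕ
cellSum h = h false false + h false true + h true false + h true true

cellSum-cong : ∀ {h k : Bool → Bool → ℕ} → (∀ a b → h a b ≡ k a b) → cellSum h ≡ cellSum k
cellSum-cong eq =
  cong₂ _+_ (cong₂ _+_ (cong₂ _+_ (eq false false) (eq false true)) (eq true false)) (eq true true)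

sum-cellSum : ∀ {n} (h : Bool → Bool → Fin n → ℕ) →
  ∑[ u < n ] cellSum (λ a b → h a b u) ≡ cellSum (λ a b → sum (h a b))
sum-cellSum h =
  trans (∑-distrib-+ (λ u → h false false u + h false true u + h true false u) (h true true))
        (cong (_+ sum (h true true))
          (trans (∑-distrib-+ (λ u → h false false u + h false true u) (h true false))
                 (cong (_+ sum (h true false)) (∑-distrib-+ (h false false) (h false true)))))

cell-expand : ∀ a b (g : Bool → Bool → ℕ) →
  g a b ≡ cellSum (λ a′ b′ → 𝟙 ((a == a′) ∧ (b == b′)) * g a′ b′)
cell-expand false false g = expand (g false false) (g false true) (g true false) (g true true)
  where expand : ∀ x y z w → x ≡ 1 * x + 0 * y + 0 * z + 0 * w
        expand = solve-∀
cell-expand false true  g = expand (g false false) (g false true) (g true false) (g true true)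
  where expand : ∀ x y z w → y ≡ 0 * x + 1 * y + 0 * z + 0 * w
        expand = solve-∀
cell-expand true  false g = expand (g false false) (g false true) (g true false) (g true true)
  where expand : ∀ x y z w → z ≡ 0 * x + 0 * y + 1 * z + 0 * w
        expand = solve-∀
cell-expand true  true  g = expand (g false false) (g false true) (g true false) (g true true)
  where expand : ∀ x y z w → w ≡ 0 * x + 0 * y + 0 * z + 1 * w
        expand = solve-∀

xor≡==not : ∀ a b → a xor b ≡ (b == not a)
xor≡==not false false = refl
xor≡==not false true  = refl
xor≡==not true  false = refl
xor≡==not true  true  = refl

𝟙-∧ : ∀ a b → 𝟙 a * 𝟙 b ≡ 𝟙 (a ∧ b)
𝟙-∧ false _     = refl
𝟙-∧ true  false = refl
𝟙-∧ true  true  = refl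

𝟙-splitʳ : ∀ p q → 𝟙 p ≡ 𝟙 (p ∧ (q == false)) + 𝟙 (p ∧ (q == true))
𝟙-splitʳ false _     = refl
𝟙-splitʳ true  false = refl
𝟙-splitʳ true  true  = refl

𝟙-splitˡ : ∀ p q → 𝟙 q ≡ 𝟙 ((p == false) ∧ q) + 𝟙 ((p == true) ∧ q)
𝟙-splitˡ false q = sym (+-identityʳ (𝟙 q))
𝟙-splitˡ true  q = refl

-- pairTerm is pairPolynomial a b c e (a ∸ 1) (b ∸ 1) (c ∸ 1) (e ∸ 1); abstracting the
-- predecessors leaves identities the ring solver can check.
pairPolynomial : ℕ → ℕ → ℕ → ℕ → ℕ → ℕ → ℕ → ℕ → ℕ
pairPolynomial a b c e a′ b′ c′ e′ =
  3 * a * b * c + 3 * a * b * e + 3 * a * c * e + 3 * b * c * e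
  + a * e * e′ + b * c * c′ + c * b * b′ + e * a * a′

pairPolynomial-diagonal : ∀ a e a′ e′ → pairPolynomial a 0 0 e a′ 0 0 e′ ≡ a * e * e′ + e * a * a′
pairPolynomial-diagonal = diagonal
  where
  diagonal : ∀ a e a′ e′ →
    3 * a * 0 * 0 + 3 * a * 0 * e + 3 * a * 0 * e + 3 * 0 * 0 * e
    + a * e * e′ + 0 * 0 * 0 + 0 * 0 * 0 + e * a * a′
    ≡ a * e * e′ + e * a * a′
  diagonal = solve-∀

m*m≡m+m*[m∸1] : ∀ m → m * m ≡ m + m * (m ∸ 1)
m*m≡m+m*[m∸1] zero    = refl
m*m≡m+m*[m∸1] (suc m) = square m
  where
  square : ∀ m → suc m * suc m ≡ suc m + suc m * m
  square = solve-∀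

cells-identity : ∀ a b c e →
  a * ((c + e) * (b + e)) + b * ((c + e) * (a + c)) + c * ((a + b) * (b + e)) + e * ((a + b) * (a + c))
  ≡ (a * e + b * c + c * b + e * a) + pairPolynomial a b c e (a ∸ 1) (b ∸ 1) (c ∸ 1) (e ∸ 1)
cells-identity a b c e = begin
  a * ((c + e) * (b + e)) + b * ((c + e) * (a + c)) + c * ((a + b) * (b + e)) + e * ((a + b) * (a + c))
    ≡⟨ expand a b c e ⟩
  cubic + a * (e * e) + b * (c * c) + c * (b * b) + e * (a * a)
    ≡⟨ cong₂ _+_ (cong₂ _+_ (cong₂ _+_ (cong (λ x → cubic + a * x) (m*m≡m+m*[m∸1] e))
                                       (cong (b *_) (m*m≡m+m*[m∸1] c)))
                            (cong (c *_) (m*m≡m+m*[m∸1] b)))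
                 (cong (e *_) (m*m≡m+m*[m∸1] a)) ⟩
  cubic + a * (e + e * (e ∸ 1)) + b * (c + c * (c ∸ 1)) + c * (b + b * (b ∸ 1)) + e * (a + a * (a ∸ 1))
    ≡⟨ collect a b c e (a ∸ 1) (b ∸ 1) (c ∸ 1) (e ∸ 1) ⟩
  (a * e + b * c + c * b + e * a) + pairPolynomial a b c e (a ∸ 1) (b ∸ 1) (c ∸ 1) (e ∸ 1) ∎
  where
  open ≡-Reasoning
  cubic : ℕ
  cubic = 3 * a * b * c + 3 * a * b * e + 3 * a * c * e + 3 * b * c * e

  expand : ∀ a b c e →
    a * ((c + e) * (b + e)) + b * ((c + e) * (a + c)) + c * ((a + b) * (b + e)) + e * ((a + b) * (a + c))
    ≡ 3 * a * b * c + 3 * a * b * e + 3 * a * c * e + 3 * b * c * e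
      + a * (e * e) + b * (c * c) + c * (b * b) + e * (a * a)
  expand = solve-∀

  collect : ∀ a b c e a′ b′ c′ e′ →
    3 * a * b * c + 3 * a * b * e + 3 * a * c * e + 3 * b * c * e
    + a * (e + e * e′) + b * (c + c * c′) + c * (b + b * b′) + e * (a + a * a′)
    ≡ (a * e + b * c + c * b + e * a)
      + (3 * a * b * c + 3 * a * b * e + 3 * a * c * e + 3 * b * c * e
         + a * e * e′ + b * c * c′ + c * b * b′ + e * a * a′)
  collect = solve-∀

module Cuts {n d : ℕ} (side : Fin d → Fin n → Bool) where

  cut : Fin d → Fin n → Fin n → ℕ
  cut i u v = 𝟙 (side i u xor side i v)

  cutDistance : Fin n → Fin n → ℕ
  cutDistance u v = ∑[ i < d ] cut i u v

  cutDistance-refl : ∀ u → cutDistance u u ≡ 0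
  cutDistance-refl u = trans (sum-cong-≗ (λ i → cong 𝟙 (xor-same (side i u)))) (sum-replicate-zero d)

  cell : Fin d → Fin d → Bool → Bool → ℕ
  cell = nIJ side

  cutCount : Fin d → Fin n → ℕ
  cutCount i u = ∑[ v < n ] cut i u v

  cutCount≡ : ∀ i u → cutCount i u ≡ nI side i (not (side i u))
  cutCount≡ i u =
    trans (sum-cong-≗ (λ v → cong 𝟙 (xor≡==not (side i u) (side i v)))) (sym (count≡sum n _))

  jointCutCount≡ : ∀ i j u →
    ∑[ v < n ] (cut i u v * cut j u v) ≡ cell i j (not (side i u)) (not (side j u))
  jointCutCount≡ i j u = trans (sum-cong-≗ both) (sym (count≡sum n _))
    where
    both : ∀ v → cut i u v * cut j u v
               ≡ 𝟙 ((side i v == not (side i u)) ∧ (side j v == not (side j u)))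
    both v rewrite xor≡==not (side i u) (side i v) | xor≡==not (side j u) (side j v) =
      𝟙-∧ (side i v == not (side i u)) (side j v == not (side j u))

  nI-splitʳ : ∀ i j a → nI side i a ≡ cell i j a false + cell i j a true
  nI-splitʳ i j a = count-+ n _ _ _ (λ v → 𝟙-splitʳ (side i v == a) (side j v))

  nI-splitˡ : ∀ i j b → nI side j b ≡ cell i j false b + cell i j true b
  nI-splitˡ i j b = count-+ n _ _ _ (λ v → 𝟙-splitˡ (side i v) (side j v == b))

  sum-by-cells : ∀ i j (g : Bool → Bool → ℕ) →
    ∑[ u < n ] g (side i u) (side j u) ≡ cellSum (λ a b → cell i j a b * g a b)
  sum-by-cells i j g = begin
    ∑[ u < n ] g (side i u) (side j u)
      ≡⟨ sum-cong-≗ (λ u → cell-expand (side i u) (side j u) g) ⟩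
    ∑[ u < n ] cellSum (λ a b → inCell a b u * g a b)
      ≡⟨ sum-cellSum (λ a b u → inCell a b u * g a b) ⟩
    cellSum (λ a b → ∑[ u < n ] (inCell a b u * g a b))
      ≡⟨ cellSum-cong collapse ⟩
    cellSum (λ a b → cell i j a b * g a b) ∎
    where
    open ≡-Reasoning
    inCell : Bool → Bool → Fin n → ℕ
    inCell a b u = 𝟙 ((side i u == a) ∧ (side j u == b))

    collapse : ∀ a b → ∑[ u < n ] (inCell a b u * g a b) ≡ cell i j a b * g a b
    collapse a b =
      trans (sym (*-distribʳ-sum (g a b) (inCell a b))) (cong (_* g a b) (sym (count≡sum n _)))

  cutCountProducts jointCuts : Fin d → Fin d → ℕ
  cutCountProducts i j = ∑[ u < n ] (cutCount i u * cutCount j u)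
  jointCuts        i j = ∑[ u < n ] ∑[ v < n ] (cut i u v * cut j u v)

  cutCountProducts≡ : ∀ i j → cutCountProducts i j ≡ jointCuts i j + pairTerm side i j
  cutCountProducts≡ i j = begin
    ∑[ u < n ] (cutCount i u * cutCount j u)
      ≡⟨ sum-cong-≗ (λ u → cong₂ _*_ (cutCount≡ i u) (cutCount≡ j u)) ⟩
    ∑[ u < n ] (nI side i (not (side i u)) * nI side j (not (side j u)))
      ≡⟨ sum-by-cells i j (λ a b → nI side i (not a) * nI side j (not b)) ⟩
    cellSum (λ a b → cell i j a b * (nI side i (not a) * nI side j (not b)))
      ≡⟨ cellSum-cong (λ a b → cong (cell i j a b *_)
           (cong₂ _*_ (nI-splitʳ i j (not a)) (nI-splitˡ i j (not b)))) ⟩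
    cellSum (λ a b → cell i j a b * ((cell i j (not a) false + cell i j (not a) true)
                                     * (cell i j false (not b) + cell i j true (not b))))
      ≡⟨ cells-identity (cell i j false false) (cell i j false true)
                        (cell i j true false) (cell i j true true) ⟩
    cellSum (λ a b → cell i j a b * cell i j (not a) (not b)) + pairTerm side i j
      ≡⟨ cong (_+ pairTerm side i j) (sum-by-cells i j (λ a b → cell i j (not a) (not b))) ⟨
    ∑[ u < n ] cell i j (not (side i u)) (not (side j u)) + pairTerm side i j
      ≡⟨ cong (_+ pairTerm side i j) (sum-cong-≗ (jointCutCount≡ i j)) ⟨
    jointCuts i j + pairTerm side i j ∎
    where open ≡-Reasoning

  pairTerm-sym : ∀ i j → pairTerm side i j ≡ pairTerm side j i
  pairTerm-sym i j = +-cancelˡ-≡ (jointCuts i j) _ _ (begin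
    jointCuts i j + pairTerm side i j  ≡⟨ cutCountProducts≡ i j ⟨
    cutCountProducts i j               ≡⟨ sum-cong-≗ (λ u → *-comm (cutCount i u) (cutCount j u)) ⟩
    cutCountProducts j i               ≡⟨ cutCountProducts≡ j i ⟩
    jointCuts j i + pairTerm side j i  ≡⟨ cong (_+ pairTerm side j i) jointCuts-sym ⟩
    jointCuts i j + pairTerm side j i  ∎)
    where
    open ≡-Reasoning
    jointCuts-sym : jointCuts j i ≡ jointCuts i j
    jointCuts-sym = sum-cong-≗ (λ u → sum-cong-≗ (λ v → *-comm (cut j u v) (cut i u v)))

  pairTerm-diagonal : ∀ i → pairTerm side i i ≡ singleTerm side i
  pairTerm-diagonal i = begin
    pairTerm side i i                  ≡⟨ vanish (off-diagonal false) (off-diagonal true) ⟩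
    a * e * (e ∸ 1) + e * a * (a ∸ 1)  ≡⟨ cong₂ (λ x y → x * y * (y ∸ 1) + y * x * (x ∸ 1))
                                                (diagonal false) (diagonal true) ⟩
    singleTerm side i                  ∎
    where
    open ≡-Reasoning
    a e : ℕ
    a = cell i i false false
    e = cell i i true true

    diagonal : ∀ x → cell i i x x ≡ nI side i x
    diagonal x = trans (count≡sum n _)
      (trans (sum-cong-≗ (λ v → cong 𝟙 (∧-idem (side i v == x)))) (sym (count≡sum n _)))

    off-diagonal : ∀ x → cell i i x (not x) ≡ 0
    off-diagonal x = trans (count≡sum n _)
      (trans (sum-cong-≗ (λ v → cong 𝟙 (contradictory (side i v) x))) (sum-replicate-zero n))
      where
      contradictory : ∀ s x → (s == x) ∧ (s == not x) ≡ false
      contradictory false false = refl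
      contradictory false true  = refl
      contradictory true  false = refl
      contradictory true  true  = refl

    vanish : ∀ {b c} → b ≡ 0 → c ≡ 0 →
      pairPolynomial a b c e (a ∸ 1) (b ∸ 1) (c ∸ 1) (e ∸ 1) ≡ a * e * (e ∸ 1) + e * a * (a ∸ 1)
    vanish refl refl = pairPolynomial-diagonal a e (a ∸ 1) (e ∸ 1)

  ŴW-cutDistance : ŴW cutDistance
    ≡ ∑[ i < d ] singleTerm side i + 2 * ∑[ i < d ] ∑[ j < d ] strictlyUpper (pairTerm side) i j
  ŴW-cutDistance = begin
    ŴW cutDistance
      ≡⟨ +-cancelʳ-≡ (∑∑ jointCuts) _ _ decomposition ⟩
    ∑∑ (pairTerm side)
      ≡⟨ sum-symmetric (pairTerm side) pairTerm-sym ⟩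
    ∑[ i < d ] pairTerm side i i + 2 * ∑∑ (strictlyUpper (pairTerm side))
      ≡⟨ cong (_+ 2 * ∑∑ (strictlyUpper (pairTerm side))) (sum-cong-≗ pairTerm-diagonal) ⟩
    ∑[ i < d ] singleTerm side i + 2 * ∑∑ (strictlyUpper (pairTerm side)) ∎
    where
    open ≡-Reasoning
    ∑∑ : (Fin d → Fin d → ℕ) → ℕ
    ∑∑ f = ∑[ i < d ] ∑[ j < d ] f i j

    square-of-row : ∀ u → sum (cutDistance u) * sum (cutDistance u)
                        ≡ ∑[ i < d ] ∑[ j < d ] (cutCount i u * cutCount j u)
    square-of-row u =
      trans (cong (λ s → s * s) (∑-comm (λ v i → cut i u v)))
            (sum-*-sum (λ i → cutCount i u) (λ i → cutCount i u))

    squares : ∑[ u < n ] ∑[ v < n ] (cutDistance u v * cutDistance u v) ≡ ∑∑ jointCuts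
    squares = begin
      ∑[ u < n ] ∑[ v < n ] (cutDistance u v * cutDistance u v)
        ≡⟨ sum-cong-≗ (λ u → sum-cong-≗ (λ v → sum-*-sum (λ i → cut i u v) (λ i → cut i u v))) ⟩
      ∑[ u < n ] ∑[ v < n ] ∑[ i < d ] ∑[ j < d ] (cut i u v * cut j u v)
        ≡⟨ sum-cong-≗ (λ u → ∑-comm² (λ v i j → cut i u v * cut j u v)) ⟩
      ∑[ u < n ] ∑[ i < d ] ∑[ j < d ] ∑[ v < n ] (cut i u v * cut j u v)
        ≡⟨ ∑-comm² (λ u i j → ∑[ v < n ] (cut i u v * cut j u v)) ⟩
      ∑∑ jointCuts ∎

    decomposition : ŴW cutDistance + ∑∑ jointCuts ≡ ∑∑ (pairTerm side) + ∑∑ jointCuts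
    decomposition = begin
      ŴW cutDistance + ∑∑ jointCuts
        ≡⟨ cong (ŴW cutDistance +_) squares ⟨
      ŴW cutDistance + ∑[ u < n ] ∑[ v < n ] (cutDistance u v * cutDistance u v)
        ≡⟨ ŴW+squares cutDistance cutDistance-refl ⟩
      ∑[ u < n ] (sum (cutDistance u) * sum (cutDistance u))
        ≡⟨ sum-cong-≗ square-of-row ⟩
      ∑[ u < n ] ∑[ i < d ] ∑[ j < d ] (cutCount i u * cutCount j u)
        ≡⟨ ∑-comm² (λ u i j → cutCount i u * cutCount j u) ⟩
      ∑∑ cutCountProducts
        ≡⟨ sum-cong-≗ (λ i → sum-cong-≗ (cutCountProducts≡ i)) ⟩
      ∑∑ (λ i j → jointCuts i j + pairTerm side i j)
        ≡⟨ ∑∑-distrib-+ jointCuts (pairTerm side) ⟩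
      ∑∑ jointCuts + ∑∑ (pairTerm side)
        ≡⟨ +-comm (∑∑ jointCuts) _ ⟩
      ∑∑ (pairTerm side) + ∑∑ jointCuts ∎

-- Walks and distances

module Walks {n : ℕ} (B : Adj n) where

  data Walk : Fin n → Fin n → ℕ → Set where
    nil  : ∀ {u} → Walk u u 0
    step : ∀ {u v k} w → B u w ≡ true → Walk w v k → Walk u v (suc k)

  walkExact⇒Walk : ∀ k u v → walkExact B k u v ≡ true → Walk u v k
  walkExact⇒Walk zero u v e with u ≟ v
  walkExact⇒Walk zero u .u e | yes refl = nil
  walkExact⇒Walk zero u v () | no _
  walkExact⇒Walk (suc k) u v e
    with w , uw∧wv ← satisfied (any⁻ (λ w → B u w ∧ walkExact B k w v) (allFin n)
                                     (Equivalence.from T-≡ e))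
    with uw , wv ← Equivalence.to T-∧ uw∧wv
    = step w (Equivalence.to T-≡ uw) (walkExact⇒Walk k w v (Equivalence.to T-≡ wv))

  Walk⇒walkExact : ∀ {u v k} → Walk u v k → walkExact B k u v ≡ true
  Walk⇒walkExact {u} nil with u ≟ u
  ... | yes _  = refl
  ... | no u≢u = ⊥-elim (u≢u refl)
  Walk⇒walkExact {u} {v} {suc k} (step w uw wv) =
    Equivalence.to T-≡ (any⁺ (λ w → B u w ∧ walkExact B k w v) (lose (∈-allFin w)
      (Equivalence.from T-∧ (Equivalence.from T-≡ uw , Equivalence.from T-≡ (Walk⇒walkExact wv)))))

  vertexAt : ∀ {u v k} → Walk u v k → Fin (suc k) → Fin n
  vertexAt {u} _               Fin.zero    = u
  vertexAt     (step _ _ walk) (Fin.suc i) = vertexAt walk i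

  take : ∀ {u v k} (walk : Walk u v k) (i : Fin (suc k)) → Walk u (vertexAt walk i) (toℕ i)
  take _                Fin.zero    = nil
  take (step w uw walk) (Fin.suc i) = step w uw (take walk i)

  drop : ∀ {u v k} (walk : Walk u v k) (i : Fin (suc k)) → Walk (vertexAt walk i) v (k ∸ toℕ i)
  drop walk            Fin.zero    = walk
  drop (step _ _ walk) (Fin.suc i) = drop walk i

  _++_ : ∀ {u w v k l} → Walk u w k → Walk w v l → Walk u v (k + l)
  nil            ++ walk′ = walk′
  step w uw walk ++ walk′ = step w uw (walk ++ walk′)

  -- A walk with at least n steps repeats a vertex; cutting out the closed part shortens it.
  shorten : ∀ {u v k} → n ≤ k → Walk u v k → ∃ λ m → m < k × Walk u v m
  shorten {u} {v} {k} n≤k walk with i , j , i<j , same ← pigeonhole (s≤s n≤k) (vertexAt walk) =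
    toℕ i + (k ∸ toℕ j) ,
    ≤-trans (+-monoˡ-< (k ∸ toℕ j) i<j) (≤-reflexive (m+[n∸m]≡n (≤-pred (toℕ<n j)))) ,
    take walk i ++ subst (λ x → Walk x v (k ∸ toℕ j)) (sym same) (drop walk j)

  short-walk : ∀ {u v k} → Walk u v k → ∃ λ m → m < n × Walk u v m
  short-walk {u} {v} {k} = <-rec (λ k → Walk u v k → ∃ λ m → m < n × Walk u v m) shorter k
    where
    shorter : ∀ k → (∀ {m} → m < k → Walk u v m → ∃ λ l → l < n × Walk u v l) →
      Walk u v k → ∃ λ m → m < n × Walk u v m
    shorter k rec walk with n ≤? k
    ... | no  n≰k = k , ≰⇒> n≰k , walk
    ... | yes n≤k with m , m<k , walk′ ← shorten n≤k walk = rec m<k walk′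

  distFrom-walk : ∀ u v k fuel m → k ≤ m → m < k + fuel → walkExact B m u v ≡ true →
    walkExact B (distFrom B u v k fuel) u v ≡ true
  distFrom-walk u v k zero m k≤m m<k+0 _ =
    ⊥-elim (≤⇒≯ k≤m (subst (m <_) (+-identityʳ k) m<k+0))
  distFrom-walk u v k (suc fuel) m k≤m m<k+fuel walk-m with walkExact B k u v in walk-k
  ... | true  = walk-k
  ... | false =
    distFrom-walk u v (suc k) fuel m (≤∧≢⇒< k≤m k≢m) (subst (m <_) (+-suc k fuel) m<k+fuel) walk-m
    where
    k≢m : k ≢ m
    k≢m refl with () ← trans (sym walk-k) walk-m

  geodesic : ∀ {u v} → Reachable B u v → Walk u v (dist B u v)
  geodesic {u} {v} (k , walk-k) with m , m<n , walk ← short-walk (walkExact⇒Walk k u v walk-k) =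
    walkExact⇒Walk (dist B u v) u v (distFrom-walk u v 0 n m z≤n m<n (Walk⇒walkExact walk))

dist-adjacent : ∀ {n} (B : Adj n) {x y} → x ≢ y → B x y ≡ true → dist B x y ≡ 1
dist-adjacent {suc zero}    B {Fin.zero} {Fin.zero} x≢y _ = ⊥-elim (x≢y refl)
dist-adjacent {suc (suc n)} B {x} {y} x≢y xy with x ≟ y
... | yes x≡y = ⊥-elim (x≢y x≡y)
... | no  _   = cong (λ b → if b then 1 else distFrom B x y 2 n)
                     (Walks.Walk⇒walkExact B (Walks.step y xy Walks.nil))

removeClass⁺ : ∀ {n d} (A : Adj n) (cls : Fin n → Fin n → Fin d) {i u w} →
  A u w ≡ true → cls u w ≢ i → removeClass A cls i u w ≡ true
removeClass⁺ A cls {i} {u} {w} uw uw∉i with cls u w ≟ i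
... | yes uw∈i = ⊥-elim (uw∉i uw∈i)
... | no  _    = cong (_∧ true) uw

removeClass⁻ : ∀ {n d} (A : Adj n) (cls : Fin n → Fin n → Fin d) {i u w} →
  removeClass A cls i u w ≡ true → A u w ≡ true × cls u w ≢ i
removeClass⁻ A cls {i} {u} {w} e with A u w | cls u w ≟ i
... | true  | no uw∉i = refl , uw∉i
... | true  | yes _   with () ← e
... | false | _       with () ← e

-- Partial cubes

xor≡false⇒≡ : ∀ {a b} → a xor b ≡ false → a ≡ b
xor≡false⇒≡ {false} {false} _ = refl
xor≡false⇒≡ {true}  {true}  _ = refl

≡⇒xor≡false : ∀ {a b} → a ≡ b → a xor b ≡ false
≡⇒xor≡false {a} refl = xor-same a

≢⇒xor≡true : ∀ {a b} → a ≢ b → a xor b ≡ true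
≢⇒xor≡true {false} {false} a≢b = ⊥-elim (a≢b refl)
≢⇒xor≡true {false} {true}  _   = refl
≢⇒xor≡true {true}  {false} _   = refl
≢⇒xor≡true {true}  {true}  a≢b = ⊥-elim (a≢b refl)

𝟙-xor-triangle : ∀ a b c → 𝟙 (a xor c) ≤ 𝟙 (a xor b) + 𝟙 (b xor c)
𝟙-xor-triangle false false c     = ≤-refl
𝟙-xor-triangle false true  false = z≤n
𝟙-xor-triangle false true  true  = s≤s z≤n
𝟙-xor-triangle true  false false = s≤s z≤n
𝟙-xor-triangle true  false true  = z≤n
𝟙-xor-triangle true  true  c     = m≤n+m (𝟙 (true xor c)) 0

-- One coordinate of d(x,x′) + d(y,y′) versus d(x,y′) + d(y,x′), for edges xy and x′y′.
pairings-agree : ∀ a b a′ b′ → a ≡ b ⊎ a′ ≡ b′ →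
  𝟙 (a xor a′) + 𝟙 (b xor b′) ≡ 𝟙 (a xor b′) + 𝟙 (b xor a′)
pairings-agree a _ a′ b′ (inj₁ refl) = +-comm (𝟙 (a xor a′)) (𝟙 (a xor b′))
pairings-agree _ _ _  _  (inj₂ refl) = refl

pairings-differ : ∀ a b a′ b′ → a xor b ≡ true → a′ xor b′ ≡ true →
  𝟙 (a xor a′) + 𝟙 (b xor b′) ≢ 𝟙 (a xor b′) + 𝟙 (b xor a′)
pairings-differ false false _     _     () _
pairings-differ true  true  _     _     () _
pairings-differ _     _     false false _  ()
pairings-differ _     _     true  true  _  ()
pairings-differ false true  false true  _  _ ()
pairings-differ false true  true  false _  _ ()
pairings-differ true  false false true  _  _ ()
pairings-differ true  false true  false _  _ ()

hamming≡sum : ∀ {K} (p q : Vec Bool K) → hamming p q ≡ ∑[ c < K ] 𝟙 (lookup p c xor lookup q c)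
hamming≡sum Vec.[]      Vec.[]      = refl
hamming≡sum (x Vec.∷ p) (y Vec.∷ q) = cong (𝟙 (x xor y) +_) (hamming≡sum p q)

module PartialCube {n K : ℕ} (A : Adj n) (simple : IsSimpleGraph A) (connected : IsConnected A)
  (f : Fin n → Vec Bool K) (isometric : ∀ u v → dist A u v ≡ hamming (f u) (f v)) where

  open Walks A

  differs : Fin n → Fin n → Fin K → Bool
  differs u v c = lookup (f u) c xor lookup (f v) c

  dist≡∑differs : ∀ u v → dist A u v ≡ ∑[ c < K ] 𝟙 (differs u v c)
  dist≡∑differs u v = trans (isometric u v) (hamming≡sum (f u) (f v))

  edge-differs-once : ∀ {x y} → A x y ≡ true → ∑[ c < K ] 𝟙 (differs x y c) ≡ 1
  edge-differs-once {x} {y} xy = trans (sym (dist≡∑differs x y)) (dist-adjacent A x≢y xy)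
    where
    x≢y : x ≢ y
    x≢y refl with () ← trans (sym xy) (proj₂ simple x)

  FlipsOnly : Fin n → Fin n → Fin K → Set
  FlipsOnly x y c = differs x y c ≡ true × (∀ t → t ≢ c → differs x y t ≡ false)

  edge-flips : ∀ {x y} → A x y ≡ true → ∃ (FlipsOnly x y)
  edge-flips {x} {y} xy = sum-indicator≡1 (differs x y) (edge-differs-once xy)

  flipsOnly-unique : ∀ {x y c t} → FlipsOnly x y c → differs x y t ≡ true → t ≡ c
  flipsOnly-unique {c = c} {t} (_ , others) flips-t with t ≟ c
  ... | yes t≡c = t≡c
  ... | no  t≢c with () ← trans (sym flips-t) (others t t≢c)

  module Crossing (x y x′ y′ : Fin n) where

    straight crossed : Fin K → ℕ
    straight t = 𝟙 (differs x x′ t) + 𝟙 (differs y y′ t)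
    crossed  t = 𝟙 (differs x y′ t) + 𝟙 (differs y x′ t)

    straight-sum : dist A x x′ + dist A y y′ ≡ sum straight
    straight-sum = trans (cong₂ _+_ (dist≡∑differs x x′) (dist≡∑differs y y′))
                         (sym (∑-distrib-+ (𝟙 ∘ differs x x′) (𝟙 ∘ differs y y′)))

    crossed-sum : dist A x y′ + dist A y x′ ≡ sum crossed
    crossed-sum = trans (cong₂ _+_ (dist≡∑differs x y′) (dist≡∑differs y x′))
                        (sym (∑-distrib-+ (𝟙 ∘ differs x y′) (𝟙 ∘ differs y x′)))

    straight≡crossed : ∀ t → differs x y t ≡ false ⊎ differs x′ y′ t ≡ false →
      straight t ≡ crossed t
    straight≡crossed t one-edge =
      pairings-agree (lookup (f x) t) (lookup (f y) t) (lookup (f x′) t) (lookup (f y′) t)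
                     (Sum.map xor≡false⇒≡ xor≡false⇒≡ one-edge)

    Θ⇒same-coordinate : ∀ {c c′} → FlipsOnly x y c → FlipsOnly x′ y′ c′ → Θ A x y x′ y′ → c ≡ c′
    Θ⇒same-coordinate {c} {c′} (_ , xy-only) (_ , x′y′-only) θ with c ≟ c′
    ... | yes c≡c′ = c≡c′
    ... | no  c≢c′ = ⊥-elim (θ (begin
      dist A x x′ + dist A y y′  ≡⟨ straight-sum ⟩
      sum straight               ≡⟨ sum-cong-≗ (λ t → straight≡crossed t (one-edge t)) ⟩
      sum crossed                ≡⟨ crossed-sum ⟨
      dist A x y′ + dist A y x′  ∎))
      where
      open ≡-Reasoning
      one-edge : ∀ t → differs x y t ≡ false ⊎ differs x′ y′ t ≡ false
      one-edge t with t ≟ c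
      ... | no  t≢c  = inj₁ (xy-only t t≢c)
      ... | yes refl = inj₂ (x′y′-only t c≢c′)

    same-coordinate⇒Θ : ∀ {c} → FlipsOnly x y c → FlipsOnly x′ y′ c → Θ A x y x′ y′
    same-coordinate⇒Θ {c} (xy-c , xy-only) (x′y′-c , _) eq =
      pairings-differ (lookup (f x) c) (lookup (f y) c) (lookup (f x′) c) (lookup (f y′) c)
                      xy-c x′y′-c
        (+-cancelʳ-≡ (∑[ t < K ] masked crossed t) _ _ (begin
          straight c + ∑[ t < K ] masked crossed t   ≡⟨ cong (straight c +_) (sum-cong-≗ masked-agree) ⟨
          straight c + ∑[ t < K ] masked straight t  ≡⟨ sum-except straight c ⟨
          sum straight                               ≡⟨ straight-sum ⟨
          dist A x x′ + dist A y y′                  ≡⟨ eq ⟩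
          dist A x y′ + dist A y x′                  ≡⟨ crossed-sum ⟩
          sum crossed                                ≡⟨ sum-except crossed c ⟩
          crossed c + ∑[ t < K ] masked crossed t    ∎))
      where
      open ≡-Reasoning
      masked : (Fin K → ℕ) → Fin K → ℕ
      masked g t = if isYes (c ≟ t) then 0 else g t

      masked-agree : ∀ t → masked straight t ≡ masked crossed t
      masked-agree t with c ≟ t
      ... | yes _   = refl
      ... | no  c≢t = straight≡crossed t (inj₁ (xy-only t (c≢t ∘ sym)))

  flips : ∀ {u v k} → Walk u v k → Fin K → ℕ
  flips     nil             c = 0
  flips {u} (step w _ walk) c = 𝟙 (differs u w c) + flips walk c

  ∑flips≡length : ∀ {u v k} (walk : Walk u v k) → ∑[ c < K ] flips walk c ≡ k
  ∑flips≡length     nil              = sum-replicate-zero K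
  ∑flips≡length {u} (step w uw walk) =
    trans (∑-distrib-+ (𝟙 ∘ differs u w) (flips walk))
          (cong₂ _+_ (edge-differs-once uw) (∑flips≡length walk))

  differs≤flips : ∀ {u v k} (walk : Walk u v k) c → 𝟙 (differs u v c) ≤ flips walk c
  differs≤flips {u}     nil             c = ≤-reflexive (cong 𝟙 (xor-same (lookup (f u) c)))
  differs≤flips {u} {v} (step w _ walk) c =
    ≤-trans (𝟙-xor-triangle (lookup (f u) c) (lookup (f w) c) (lookup (f v) c))
            (+-monoʳ-≤ (𝟙 (differs u w c)) (differs≤flips walk c))

  shortest : ∀ u v → Walk u v (dist A u v)
  shortest u v = geodesic (connected u v)

  -- Flips dominate differences coordinatewise, and for a shortest walk both sum to d(u,v).
  shortest-flips : ∀ u v c → flips (shortest u v) c ≡ 𝟙 (differs u v c)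
  shortest-flips u v c =
    sym (sum-≤-≡ (𝟙 ∘ differs u v) (flips (shortest u v)) (differs≤flips (shortest u v))
                 (trans (sym (dist≡∑differs u v)) (sym (∑flips≡length (shortest u v)))) c)

  flipping-edge : ∀ {u v k} t (walk : Walk u v k) → flips walk t ≢ 0 →
    ∃ λ p → ∃ λ q → A p q ≡ true × differs p q t ≡ true
  flipping-edge     t nil              no-flip   = ⊥-elim (no-flip refl)
  flipping-edge {u} t (step w uw walk) some-flip with differs u w t in uw-t
  ... | true  = u , w , uw , uw-t
  ... | false = flipping-edge t walk some-flip

  module ThetaClasses {d : ℕ} (cls : Fin n → Fin n → Fin d) (labelling : IsThetaClassLabelling A d cls)
    (side : Fin d → Fin n → Bool) (components : IsComponentLabelling A cls side) where

    open Cuts side using (cut; cutDistance)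

    module Representative (i : Fin d) where
      x y : Fin n
      x = proj₁ (proj₂ labelling i)
      y = proj₁ (proj₂ (proj₂ labelling i))

      edge : A x y ≡ true
      edge = proj₁ (proj₂ (proj₂ (proj₂ labelling i)))

      in-class : cls x y ≡ i
      in-class = proj₂ (proj₂ (proj₂ (proj₂ labelling i)))

    coordinate : Fin d → Fin K
    coordinate i = proj₁ (edge-flips (Representative.edge i))

    representative-flips : ∀ i → FlipsOnly (Representative.x i) (Representative.y i) (coordinate i)
    representative-flips i = proj₂ (edge-flips (Representative.edge i))

    class⇒flips : ∀ {p q i} → A p q ≡ true → cls p q ≡ i → differs p q (coordinate i) ≡ true
    class⇒flips {p} {q} {i} pq pq∈i with c , pq-only ← edge-flips pq =
      subst (λ t → differs p q t ≡ true) c≡coordinate (proj₁ pq-only)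
      where
      open Representative i
      c≡coordinate : c ≡ coordinate i
      c≡coordinate = Crossing.Θ⇒same-coordinate p q x y pq-only (representative-flips i)
        (proj₂ (proj₁ labelling p q x y pq edge) (trans pq∈i (sym in-class)))

    flips⇒class : ∀ {p q i} → A p q ≡ true → differs p q (coordinate i) ≡ true → cls p q ≡ i
    flips⇒class {p} {q} {i} pq flips-i with c , pq-only ← edge-flips pq = trans
      (proj₁ (proj₁ labelling p q x y pq edge)
             (Crossing.same-coordinate⇒Θ p q x y pq-only′ (representative-flips i)))
      in-class
      where
      open Representative i
      pq-only′ : FlipsOnly p q (coordinate i)
      pq-only′ = subst (FlipsOnly p q) (sym (flipsOnly-unique pq-only flips-i)) pq-only

    coordinate-injective : ∀ i j → coordinate i ≡ coordinate j → i ≡ j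
    coordinate-injective i j same = trans (sym in-class) (flips⇒class edge flips-j)
      where
      open Representative i
      flips-j : differs x y (coordinate j) ≡ true
      flips-j = subst (λ t → differs x y t ≡ true) same (proj₁ (representative-flips i))

    coordinate-covers : ∀ u v t → 𝟙 (differs u v t) ≢ 0 → ∃ λ i → coordinate i ≡ t
    coordinate-covers u v t t-differs
      with p , q , pq , pq-t ← flipping-edge t (shortest u v) (t-differs ∘ trans (sym (shortest-flips u v t)))
      with _ , pq-only ← edge-flips pq
      = cls p q ,
        trans (flipsOnly-unique pq-only (class⇒flips pq refl)) (sym (flipsOnly-unique pq-only pq-t))

    module Without (i : Fin d) = Walks (removeClass A cls i)

    avoid-class : ∀ i {u v k} (walk : Walk u v k) → flips walk (coordinate i) ≡ 0 →
      Without.Walk i u v k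
    avoid-class i     nil              _       = Without.nil
    avoid-class i {u} (step w uw walk) no-flip = Without.step w (removeClass⁺ A cls uw uw∉i)
      (avoid-class i walk (m+n≡0⇒n≡0 (𝟙 (differs u w c)) no-flip))
      where
      c : Fin K
      c = coordinate i
      uw∉i : cls u w ≢ i
      uw∉i uw∈i with () ← trans (sym (cong 𝟙 (class⇒flips uw uw∈i))) (m+n≡0⇒m≡0 _ no-flip)

    keeps-coordinate : ∀ i {u v k} → Without.Walk i u v k → differs u v (coordinate i) ≡ false
    keeps-coordinate i {u}     Without.nil              = xor-same (lookup (f u) (coordinate i))
    keeps-coordinate i {u} {v} (Without.step w uw walk) =
      ≡⇒xor≡false (trans (xor≡false⇒≡ {lookup (f u) c} edge-keeps)
                         (xor≡false⇒≡ {lookup (f w) c} {lookup (f v) c} (keeps-coordinate i walk)))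
      where
      c : Fin K
      c = coordinate i
      edge-keeps : differs u w c ≡ false
      edge-keeps with differs u w c in uw-c
      ... | false = refl
      ... | true with uw′ , uw∉i ← removeClass⁻ A cls uw = ⊥-elim (uw∉i (flips⇒class uw′ uw-c))

    cut≡differs : ∀ i u v → cut i u v ≡ 𝟙 (differs u v (coordinate i))
    cut≡differs i u v with differs u v (coordinate i) in uv-i
    ... | false = cong 𝟙 (≡⇒xor≡false same-side)
      where
      same-side : side i u ≡ side i v
      same-side = proj₂ (components i u v) (dist A u v , Without.Walk⇒walkExact i
        (avoid-class i (shortest u v) (trans (shortest-flips u v (coordinate i)) (cong 𝟙 uv-i))))
    ... | true = cong 𝟙 (≢⇒xor≡true different-sides)
      where
      different-sides : side i u ≢ side i v
      different-sides same with k , walk ← proj₁ (components i u v) same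
        with () ← trans (sym uv-i) (keeps-coordinate i (Without.walkExact⇒Walk i k u v walk))

    dist≡cutDistance : ∀ u v → dist A u v ≡ cutDistance u v
    dist≡cutDistance u v = begin
      dist A u v                                 ≡⟨ dist≡∑differs u v ⟩
      ∑[ t < K ] 𝟙 (differs u v t)               ≡⟨ reindex ⟩
      ∑[ i < d ] 𝟙 (differs u v (coordinate i))  ≡⟨ sum-cong-≗ (λ i → cut≡differs i u v) ⟨
      cutDistance u v                            ∎
      where
      open ≡-Reasoning
      reindex : ∑[ t < K ] 𝟙 (differs u v t) ≡ ∑[ i < d ] 𝟙 (differs u v (coordinate i))
      reindex = sum-reindex coordinate (𝟙 ∘ differs u v) coordinate-injective (coordinate-covers u v)

rhs≡sum : ∀ {n} d (side : Fin d → Fin n → Bool) → rhs d side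
  ≡ ∑[ i < d ] singleTerm side i + 2 * ∑[ i < d ] ∑[ j < d ] strictlyUpper (pairTerm side) i j
rhs≡sum d side = cong₂ (λ s t → s + 2 * t) (Σ[]≡sum d (singleTerm side))
  (trans (Σ[]≡sum d λ i → Σ[ d ] (upper i)) (sum-cong-≗ λ i → Σ[]≡sum d (upper i)))
  where
  upper : Fin d → Fin d → ℕ
  upper = strictlyUpper (pairTerm side)

theorem5p2 : (n : ℕ) → 3 ≤ n → (A : Adj n) → IsPartialCube A →
    (d : ℕ) → (cls : Fin n → Fin n → Fin d) → IsThetaClassLabelling A d cls →
    (side : Fin d → Fin n → Bool) → IsComponentLabelling A cls side →
    WWhat A ≡ rhs d side
theorem5p2 n _ A (simple , connected , K , f , isometric) d cls labelling side components = begin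
  WWhat A                     ≡⟨ WWhat≡ŴW A ⟩
  ŴW (dist A)                 ≡⟨ ŴW-cong dist≡cutDistance ⟩
  ŴW (Cuts.cutDistance side)  ≡⟨ Cuts.ŴW-cutDistance side ⟩
  _                           ≡⟨ rhs≡sum d side ⟨
  rhs d side                  ∎
  where
  open ≡-Reasoning
  open PartialCube A simple connected f isometric
  open ThetaClasses cls labelling side components
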